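{- Let $C$ and $C'$ be non-trivial codes in the Hamming graphs $H(n,q)$ and $H(n',q')$ respectively. If the cartesian product code $C\times C'=\{(c,c'): c\in C, c'\in C'\}$ is a completely regular code in the cartesian product graph $H(n,q)\times H(n',q')$, then $C$ is a completely regular code in $H(n,q)$ and $C'$ is a completely regular code in $H(n',q')$.
   Context: The Hamming graph $H(n,q)$ has vertex set $Q^n$ for a set $Q$ of size $q$, two words adjacent iff they differ in exactly one coordinate. The cartesian product $\Gamma\times\Sigma$ of graphs has vertex set $V\Gamma\times V\Sigma$, with $(x,y)\sim(u,v)$ iff ($x=u$ and $y\sim v$) or ($x\sim u$ and $y=v$). A code is a nonempty vertex subset; it is trivial if it has at most one vertex or is the whole vertex set. For a connected graph and code $C$, let $C_i$ be the set of vertices at distance $i$ from $C$ ($0\le i\le\rho$, $\rho$ the covering radius, the maximum distance of a vertex from $C$); $C$ is completely regular if $\{C_0,\dots,C_\rho\}$ is an equitable partition, i.e. the number of neighbours in $C_j$ of a vertex of $C_i$ depends only on $i$ and $j$. -}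

module Defs where

open import Data.Bool using (Bool; true; false; _∧_; _∨_; not; T; if_then_else_)
open import Data.Nat using (ℕ; zero; suc; _+_)
open import Data.Fin using (Fin)
open import Data.Fin.Properties using () renaming (_≟_ to _≟ᶠ_)
open import Data.Vec using (Vec; []; _∷_)
open import Data.List using (List; []; _∷_; map; concatMap; filter; length; cartesianProduct)
open import Data.Bool.ListAction using (any)
open import Data.Product using (Σ; _×_; _,_; ∃)
open import Relation.Nullary using (¬_; does)
open import Relation.Binary.PropositionalEquality using (_≡_; _≢_)
open import Relation.Binary.Definitions using (DecidableEquality)
import Data.Vec.Properties as VP
open import Data.Product.Properties using (≡-dec)

record FinGraph : Set₁ where
  field
    V     : Set
    verts : List V
    eqV   : DecidableEquality V
    adj   : V → V → Bool

open FinGraph public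

Code : FinGraph → Set
Code Γ = V Γ → Bool

NonTrivial : (Γ : FinGraph) → Code Γ → Set
NonTrivial Γ C =
  (Σ (V Γ) λ x → Σ (V Γ) λ y → T (C x) × T (C y) × x ≢ y)
  × (Σ (V Γ) λ x → ¬ T (C x))

-- within Γ C k x  =  true  iff  d(x, C) ≤ k
within : (Γ : FinGraph) → Code Γ → ℕ → V Γ → Bool
within Γ C zero    x = C x
within Γ C (suc k) x = within Γ C k x ∨ any (λ z → adj Γ x z ∧ within Γ C k z) (verts Γ)

layer : (Γ : FinGraph) → Code Γ → ℕ → V Γ → Bool
layer Γ C zero    x = C x
layer Γ C (suc i) x = within Γ C (suc i) x ∧ not (within Γ C i x)

nbrsIn : (Γ : FinGraph) → Code Γ → ℕ → V Γ → ℕ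
nbrsIn Γ C j x = length (filter (λ z → T? (adj Γ x z ∧ layer Γ C j z)) (verts Γ))
  where
  open import Data.Bool.Properties using (T?)

-- C is completely regular: the distance partition {C_0,...,C_ρ} is equitable.
-- (Layers C_i with i > ρ are empty, so quantifying over all i is harmless.)
CompletelyRegular : (Γ : FinGraph) → Code Γ → Set
CompletelyRegular Γ C =
  ∀ (i j : ℕ) (x y : V Γ) → T (layer Γ C i x) → T (layer Γ C i y) →
  nbrsIn Γ C j x ≡ nbrsIn Γ C j y

allWords : (n q : ℕ) → List (Vec (Fin q) n)
allWords zero    q = [] ∷ []
allWords (suc n) q = concatMap (λ a → map (a ∷_) (allWords n q)) (Data.List.allFin q)

diffCount : ∀ {n q} → Vec (Fin q) n → Vec (Fin q) n → ℕ
diffCount []       []       = 0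
diffCount (a ∷ xs) (b ∷ ys) = (if does (a ≟ᶠ b) then 0 else 1) + diffCount xs ys

Hamming : (n q : ℕ) → FinGraph
Hamming n q = record
  { V     = Vec (Fin q) n
  ; verts = allWords n q
  ; eqV   = VP.≡-dec _≟ᶠ_
  ; adj   = λ x y → does (diffCount x y Data.Nat.≟ 1)
  }

_□_ : FinGraph → FinGraph → FinGraph
Γ □ Σ' = record
  { V     = V Γ × V Σ'
  ; verts = cartesianProduct (verts Γ) (verts Σ')
  ; eqV   = ≡-dec (eqV Γ) (eqV Σ')
  ; adj   = λ { (x , y) (u , v) →
               (does (eqV Γ x u) ∧ adj Σ' y v) ∨ (adj Γ x u ∧ does (eqV Σ' y v)) }
  }

module Submission where

open import Defs
open import Data.Nat using (ℕ)
open import Data.Bool using (_∧_)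
open import Data.Product using (_,_; _×_)

open import Data.Nat using (zero; suc; _+_; _*_; _≤_; _≤′_; ≤′-reflexive; ≤′-step; z≤n; s≤s; _≤?_; _≟_)
open import Data.Nat.Properties
  using (+-suc; +-assoc; +-identityʳ; *-identityˡ; *-distribʳ-+; +-cancelˡ-≡; +-cancelʳ-≡; ≤⇒≤′; ≰⇒>; m≤m+n; m≤n+m)
open import Data.Nat.Tactic.RingSolver using (solve-∀)
open import Data.Bool using (Bool; true; false; not; T)
open import Data.Bool.Properties using (T?; T-≡; T-not-≡; T-∧; T-∨; ⇔→≡; ∨-identityʳ)
open import Data.Fin using (Fin)
open import Data.Fin.Properties using () renaming (_≟_ to _≟ᶠ_)
open import Data.Vec using (Vec; []; _∷_)
open import Data.Vec.Properties using (∷-injective)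
open import Data.List using (List; []; _∷_; _++_; map; concatMap; filter; length; cartesianProductWith; allFin)
open import Data.List.Relation.Unary.Any using (here; there; satisfied)
open import Data.List.Relation.Unary.Any.Properties using (any⁺; any⁻)
open import Data.List.Relation.Unary.All using (All; []; _∷_) renaming (lookup to All-lookup)
open import Data.List.Relation.Unary.AllPairs using ([]; _∷_)
open import Data.List.Relation.Unary.Unique.Propositional using (Unique)
open import Data.List.Relation.Unary.Unique.Propositional.Properties using (allFin⁺; cartesianProductWith⁺)
open import Data.List.Membership.Propositional using (_∈_; lose)
open import Data.List.Membership.Propositional.Properties using (∈-allFin; ∈-cartesianProductWith⁺; ∈-cartesianProduct⁺)
open import Data.Product using (∃; ∃₂; proj₁; proj₂)
open import Data.Sum using (_⊎_; inj₁; inj₂; map₂)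
open import Function using (_∘_; mk⇔; Equivalence)
open import Relation.Nullary using (¬_; yes; no; does; contradiction)
open import Relation.Nullary.Decidable using (Dec; toWitness; isYes≗does; dec-true)
open import Relation.Binary.Definitions using (DecidableEquality)
open import Relation.Binary.PropositionalEquality
  using (_≡_; _≢_; refl; sym; trans; cong; cong₂; subst; module ≡-Reasoning)

open Equivalence using (to; from)

-- Write D = C × C' and let d be graph distance.  In a
-- cartesian product, distances to a product code add up:
--   d((u,v), D) = d(u, C) + d(v, C').
-- Hence, for a fixed codeword y ∈ C', the fibre Γ × {y} meets the layers
-- of D exactly as Γ meets the layers of C; and replacing x by a vertex x'
-- in the same layer of C does not change the layer of any (x, v).  The
-- neighbourhood of (x, y) is the disjoint union of a vertical part
-- {x} × N(y) and a horizontal part N(x) × {y}; the horizontal part counts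
-- the neighbours of x in C_j, and the vertical part depends only on the
-- layer of x.  Complete regularity of D therefore forces the horizontal
-- counts of x and x' to agree, i.e. C is completely regular; symmetrically
-- for C'.

T-ext : ∀ {b c} → (T b → T c) → (T c → T b) → b ≡ c
T-ext f g = ⇔→≡ (mk⇔ (to T-≡ ∘ f ∘ from T-≡) (to T-≡ ∘ g ∘ from T-≡))

T-not⇒¬T : ∀ {b} → T (not b) → ¬ T b
T-not⇒¬T nb b = contradiction (trans (sym (to T-≡ b)) (to T-not-≡ nb)) λ ()

does⇒ : ∀ {A : Set} (a? : Dec A) → T (does a?) → A
does⇒ a? = toWitness ∘ subst T (sym (isYes≗does a?))

⇒does : ∀ {A : Set} (a? : Dec A) → A → T (does a?)
⇒does a? a = from T-≡ (dec-true a? a)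

bit : Bool → ℕ
bit false = 0
bit true  = 1

bit-∧ : ∀ a b → bit (a ∧ b) ≡ bit a * bit b
bit-∧ false b = refl
bit-∧ true  b = sym (+-identityʳ (bit b))

module _ {A : Set} where

  sumOver : List A → (A → ℕ) → ℕ
  sumOver []       f = 0
  sumOver (x ∷ xs) f = f x + sumOver xs f

  count : (A → Bool) → List A → ℕ
  count p xs = sumOver xs (bit ∘ p)

  length-filter≡count : ∀ (p : A → Bool) xs → length (filter (T? ∘ p) xs) ≡ count p xs
  length-filter≡count p []       = refl
  length-filter≡count p (x ∷ xs) with p x
  ... | true  = cong suc (length-filter≡count p xs)
  ... | false = length-filter≡count p xs

  sumOver-cong : ∀ {f g : A → ℕ} → (∀ x → f x ≡ g x) → ∀ xs → sumOver xs f ≡ sumOver xs g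
  sumOver-cong f≗g []       = refl
  sumOver-cong f≗g (x ∷ xs) = cong₂ _+_ (f≗g x) (sumOver-cong f≗g xs)

  count-cong : ∀ {p q : A → Bool} → (∀ x → p x ≡ q x) → ∀ xs → count p xs ≡ count q xs
  count-cong p≗q = sumOver-cong (cong bit ∘ p≗q)

  sumOver-+ : ∀ (f g : A → ℕ) xs → sumOver xs (λ x → f x + g x) ≡ sumOver xs f + sumOver xs g
  sumOver-+ f g []       = refl
  sumOver-+ f g (x ∷ xs) rewrite sumOver-+ f g xs = interchange (f x) (g x) (sumOver xs f) (sumOver xs g)
    where
    interchange : ∀ a b c d → a + b + (c + d) ≡ a + c + (b + d)
    interchange = solve-∀

  sumOver-*ʳ : ∀ (f : A → ℕ) c xs → sumOver xs (λ x → f x * c) ≡ sumOver xs f * c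
  sumOver-*ʳ f c []       = refl
  sumOver-*ʳ f c (x ∷ xs) = trans (cong (f x * c +_) (sumOver-*ʳ f c xs)) (sym (*-distribʳ-+ c (f x) _))

  count-false : ∀ xs → count (λ _ → false) xs ≡ 0
  count-false []       = refl
  count-false (x ∷ xs) = count-false xs

  Once : DecidableEquality A → A → List A → Set
  Once _≟_ x xs = count (λ u → does (x ≟ u)) xs ≡ 1

  unique⇒once : ∀ (_≟_ : DecidableEquality A) {x xs} → Unique xs → x ∈ xs → Once _≟_ x xs
  unique⇒once _≟_ {x} (x∉xs ∷ _) (here refl) with x ≟ x
  ... | yes _   = cong suc (absent _ x∉xs)
    where
    absent : ∀ {x} ys → All (x ≢_) ys → count (λ u → does (x ≟ u)) ys ≡ 0
    absent             []       []            = refl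
    absent {x}         (y ∷ ys) (x≢y ∷ x∉ys) with x ≟ y
    ... | yes x≡y = contradiction x≡y x≢y
    ... | no  _   = absent ys x∉ys
  ... | no  x≢x = contradiction refl x≢x
  unique⇒once _≟_ {x} {y ∷ ys} (y∉ys ∷ uniq) (there x∈ys) with x ≟ y
  ... | yes refl = contradiction refl (All-lookup y∉ys x∈ys)
  ... | no  _    = unique⇒once _≟_ uniq x∈ys

  sumOver-once : ∀ (_≟_ : DecidableEquality A) {x} xs → Once _≟_ x xs →
    ∀ (F : A → ℕ) → sumOver xs (λ u → bit (does (x ≟ u)) * F u) ≡ F x
  sumOver-once _≟_ {x} xs once F = begin
    sumOver xs (λ u → bit (does (x ≟ u)) * F u)  ≡⟨ sumOver-cong select xs ⟩
    sumOver xs (λ u → bit (does (x ≟ u)) * F x)  ≡⟨ sumOver-*ʳ (bit ∘ does ∘ (x ≟_)) (F x) xs ⟩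
    count (does ∘ (x ≟_)) xs * F x               ≡⟨ cong (_* F x) once ⟩
    1 * F x                                      ≡⟨ *-identityˡ (F x) ⟩
    F x                                          ∎
    where
    open ≡-Reasoning
    select : ∀ u → bit (does (x ≟ u)) * F u ≡ bit (does (x ≟ u)) * F x
    select u with x ≟ u
    ... | yes refl = refl
    ... | no  _    = refl

  count-once : ∀ (_≟_ : DecidableEquality A) {x} xs → Once _≟_ x xs →
    ∀ (h : A → Bool) → count (λ u → does (x ≟ u) ∧ h u) xs ≡ bit (h x)
  count-once _≟_ {x} xs once h =
    trans (sumOver-cong (λ u → bit-∧ (does (x ≟ u)) (h u)) xs) (sumOver-once _≟_ xs once (bit ∘ h))

sumOver-cartesianProductWith : ∀ {A B C : Set} (g : A → B → C) (f : C → ℕ) xs ys →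
  sumOver (cartesianProductWith g xs ys) f ≡ sumOver xs (λ x → sumOver ys (f ∘ g x))
sumOver-cartesianProductWith g f []       ys = refl
sumOver-cartesianProductWith g f (x ∷ xs) ys = begin
  sumOver (map (g x) ys ++ cartesianProductWith g xs ys) f
    ≡⟨ sumOver-++ (map (g x) ys) _ ⟩
  sumOver (map (g x) ys) f + sumOver (cartesianProductWith g xs ys) f
    ≡⟨ cong₂ _+_ (sumOver-map ys) (sumOver-cartesianProductWith g f xs ys) ⟩
  sumOver ys (f ∘ g x) + sumOver xs (λ x → sumOver ys (f ∘ g x))  ∎
  where
  open ≡-Reasoning
  sumOver-++ : ∀ us vs → sumOver (us ++ vs) f ≡ sumOver us f + sumOver vs f
  sumOver-++ []       vs = refl
  sumOver-++ (u ∷ us) vs = trans (cong (f u +_) (sumOver-++ us vs)) (sym (+-assoc (f u) _ _))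
  sumOver-map : ∀ zs → sumOver (map (g x) zs) f ≡ sumOver zs (f ∘ g x)
  sumOver-map []       = refl
  sumOver-map (z ∷ zs) = cong (f (g x z) +_) (sumOver-map zs)

record WellFormed (Γ : FinGraph) : Set where
  field
    complete       : ∀ x → x ∈ verts Γ
    duplicate-free : Unique (verts Γ)
    loopless       : ∀ x → adj Γ x x ≡ false

  once : ∀ x → Once (eqV Γ) x (verts Γ)
  once x = unique⇒once (eqV Γ) duplicate-free (complete x)

open WellFormed

allWords-suc : ∀ n q → allWords (suc n) q ≡ cartesianProductWith _∷_ (allFin q) (allWords n q)
allWords-suc n q = concatMap-map (allFin q)
  where
  concatMap-map : ∀ as → concatMap (λ a → map (a ∷_) (allWords n q)) as ≡ cartesianProductWith _∷_ as (allWords n q)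
  concatMap-map []       = refl
  concatMap-map (a ∷ as) = cong (map (a ∷_) (allWords n q) ++_) (concatMap-map as)

allWords-complete : ∀ n q w → w ∈ allWords n q
allWords-complete zero    q []      = here refl
allWords-complete (suc n) q (a ∷ w) =
  subst (_ ∈_) (sym (allWords-suc n q)) (∈-cartesianProductWith⁺ _∷_ (∈-allFin a) (allWords-complete n q w))

allWords-unique : ∀ n q → Unique (allWords n q)
allWords-unique zero    q = [] ∷ []
allWords-unique (suc n) q =
  subst Unique (sym (allWords-suc n q)) (cartesianProductWith⁺ _∷_ ∷-injective (allFin⁺ q) (allWords-unique n q))

diffCount-self : ∀ {n q} (x : Vec (Fin q) n) → diffCount x x ≡ 0
diffCount-self []      = refl
diffCount-self (a ∷ x) with a ≟ᶠ a
... | yes _   = diffCount-self x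
... | no  a≢a = contradiction refl a≢a

hamming-wellFormed : ∀ n q → WellFormed (Hamming n q)
hamming-wellFormed n q = record
  { complete       = allWords-complete n q
  ; duplicate-free = allWords-unique n q
  ; loopless       = λ x → cong (λ d → does (d ≟ 1)) (diffCount-self x)
  }

module Distance (Γ : FinGraph) (C : Code Γ) where

  W : ℕ → V Γ → Bool
  W = within Γ C

  within-suc⁻ : ∀ k {x} → T (W (suc k) x) → T (W k x) ⊎ ∃ λ z → T (adj Γ x z) × T (W k z)
  within-suc⁻ k {x} w = map₂ (λ far → let z , hz = satisfied (any⁻ _ (verts Γ) far) in z , to T-∧ hz) (to T-∨ w)

  within-weaken : ∀ k {x} → T (W k x) → T (W (suc k) x)
  within-weaken k w = from T-∨ (inj₁ w)

  within-step : ∀ k {x z} → z ∈ verts Γ → T (adj Γ x z) → T (W k z) → T (W (suc k) x)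
  within-step k {x} z∈ xz w = from (T-∨ {W k x}) (inj₂ (any⁺ _ (lose z∈ (from T-∧ (xz , w)))))

  within-mono : ∀ {a k x} → a ≤′ k → T (W a x) → T (W k x)
  within-mono (≤′-reflexive refl)        w = w
  within-mono {k = suc k} (≤′-step a≤′k) w = within-weaken k (within-mono a≤′k w)

  layer⇒within : ∀ i {x} → T (layer Γ C i x) → T (W i x)
  layer⇒within zero    l = l
  layer⇒within (suc i) l = proj₁ (to T-∧ l)

  layer-minimal : ∀ i a {x} → T (layer Γ C i x) → T (W a x) → i ≤ a
  layer-minimal zero    a _ _ = z≤n
  layer-minimal (suc i) a l w with suc i ≤? a
  ... | yes 1+i≤a = 1+i≤a
  ... | no  i≮a with ≰⇒> i≮a
  ...   | s≤s a≤i = contradiction (within-mono (≤⇒≤′ a≤i) w) (T-not⇒¬T (proj₂ (to T-∧ l)))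

  SameDistance : V Γ → V Γ → Set
  SameDistance x x' = ∀ k → W k x ≡ W k x'

  sameLayer⇒sameDistance : ∀ i {x x'} → T (layer Γ C i x) → T (layer Γ C i x') → SameDistance x x'
  sameLayer⇒sameDistance i l l' k = T-ext (reach l l') (reach l' l)
    where
    reach : ∀ {x x'} → T (layer Γ C i x) → T (layer Γ C i x') → T (W k x) → T (W k x')
    reach l l' w = within-mono (≤⇒≤′ (layer-minimal i k l w)) (layer⇒within i l')

layer-cong : ∀ {Γ₁ Γ₂ : FinGraph} {C₁ : Code Γ₁} {C₂ : Code Γ₂} {z₁ z₂} →
  (∀ k → within Γ₁ C₁ k z₁ ≡ within Γ₂ C₂ k z₂) → ∀ i → layer Γ₁ C₁ i z₁ ≡ layer Γ₂ C₂ i z₂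
layer-cong same zero    = same 0
layer-cong same (suc i) = cong₂ (λ a b → a ∧ not b) (same (suc i)) (same i)

nbrsIn-as-count : ∀ Γ C j x → nbrsIn Γ C j x ≡ count (λ u → adj Γ x u ∧ layer Γ C j u) (verts Γ)
nbrsIn-as-count Γ C j x = length-filter≡count _ (verts Γ)

module Product {Γ Σ : FinGraph} (wfΓ : WellFormed Γ) (wfΣ : WellFormed Σ) (C : Code Γ) (C' : Code Σ) where

  P : FinGraph
  P = Γ □ Σ

  D : Code P
  D (x , y) = C x ∧ C' y

  private
    module DΓ = Distance Γ C
    module DΣ = Distance Σ C'
    module DP = Distance P D

  adj□⁻ : ∀ {u v u' v'} → T (adj P (u , v) (u' , v')) → (u ≡ u' × T (adj Σ v v')) ⊎ (T (adj Γ u u') × v ≡ v')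
  adj□⁻ {u} {v} {u'} {v'} e with to (T-∨ {does (eqV Γ u u') ∧ adj Σ v v'}) e
  ... | inj₁ vertical   = let u≡u' , vv' = to T-∧ vertical in inj₁ (does⇒ (eqV Γ u u') u≡u' , vv')
  ... | inj₂ horizontal = let uu' , v≡v' = to T-∧ horizontal in inj₂ (uu' , does⇒ (eqV Σ v v') v≡v')

  adj□ᵛ : ∀ {u v v'} → T (adj Σ v v') → T (adj P (u , v) (u , v'))
  adj□ᵛ {u} vv' = from T-∨ (inj₁ (from T-∧ (⇒does (eqV Γ u u) refl , vv')))

  adj□ʰ : ∀ {u u' v} → T (adj Γ u u') → T (adj P (u , v) (u' , v))
  adj□ʰ {u} {u'} {v} uu' = from (T-∨ {does (eqV Γ u u') ∧ adj Σ v v}) (inj₂ (from T-∧ (uu' , ⇒does (eqV Σ v v) refl)))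

  complete□ : ∀ z → z ∈ verts P
  complete□ (u , v) = ∈-cartesianProduct⁺ (complete wfΓ u) (complete wfΣ v)

  within□⁺ : ∀ a b {u v} → T (within Γ C a u) → T (within Σ C' b v) → T (within P D (a + b) (u , v))
  within□⁺ zero zero cu cv = from T-∧ (cu , cv)
  within□⁺ zero (suc b) cu wv with DΣ.within-suc⁻ b wv
  ... | inj₁ near              = DP.within-weaken b (within□⁺ 0 b cu near)
  ... | inj₂ (v' , vv' , far)  = DP.within-step b (complete□ _) (adj□ᵛ vv') (within□⁺ 0 b cu far)
  within□⁺ (suc a) b wu wv with DΓ.within-suc⁻ a wu
  ... | inj₁ near              = DP.within-weaken (a + b) (within□⁺ a b near wv)
  ... | inj₂ (u' , uu' , far)  = DP.within-step (a + b) (complete□ _) (adj□ʰ uu') (within□⁺ a b far wv)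

  within□⁻ : ∀ k {u v} → T (within P D k (u , v)) →
    ∃₂ λ a b → a + b ≡ k × T (within Γ C a u) × T (within Σ C' b v)
  within□⁻ zero w = 0 , 0 , refl , to T-∧ w
  within□⁻ (suc k) w with DP.within-suc⁻ k w
  ... | inj₁ near with within□⁻ k near
  ...   | a , b , refl , wu , wv = a , suc b , +-suc a b , wu , DΣ.within-weaken b wv
  within□⁻ (suc k) w | inj₂ ((u' , v') , e , far) with within□⁻ k far | adj□⁻ e
  ... | a , b , refl , wu , wv | inj₁ (refl , vv') =
        a , suc b , +-suc a b , wu , DΣ.within-step b (complete wfΣ v') vv' wv
  ... | a , b , refl , wu , wv | inj₂ (uu' , refl) =
        suc a , b , refl , DΓ.within-step a (complete wfΓ u') uu' wu , wv

  within□-fibreˡ : ∀ {y} → T (C' y) → ∀ k u → within P D k (u , y) ≡ within Γ C k u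
  within□-fibreˡ {y} cy k u = T-ext shrink grow
    where
    grow : T (within Γ C k u) → T (within P D k (u , y))
    grow w = subst (λ m → T (within P D m (u , y))) (+-identityʳ k) (within□⁺ k 0 w cy)
    shrink : T (within P D k (u , y)) → T (within Γ C k u)
    shrink w with within□⁻ k w
    ... | a , b , refl , wu , _ = DΓ.within-mono (≤⇒≤′ (m≤m+n a b)) wu

  within□-fibreʳ : ∀ {x} → T (C x) → ∀ k v → within P D k (x , v) ≡ within Σ C' k v
  within□-fibreʳ {x} cx k v = T-ext shrink (within□⁺ 0 k cx)
    where
    shrink : T (within P D k (x , v)) → T (within Σ C' k v)
    shrink w with within□⁻ k w
    ... | a , b , refl , _ , wv = DΣ.within-mono (≤⇒≤′ (m≤n+m b a)) wv

  within□-cong : ∀ {x x' y y'} → DΓ.SameDistance x x' → DΣ.SameDistance y y' → DP.SameDistance (x , y) (x' , y')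
  within□-cong sx sy k = T-ext (move sx sy) (move (sym ∘ sx) (sym ∘ sy))
    where
    move : ∀ {x x' y y'} → DΓ.SameDistance x x' → DΣ.SameDistance y y' →
      T (within P D k (x , y)) → T (within P D k (x' , y'))
    move sx sy w with within□⁻ k w
    ... | a , b , refl , wu , wv = within□⁺ a b (subst T (sx a) wu) (subst T (sy b) wv)

  vertical horizontal : (V P → Bool) → V Γ → V Σ → ℕ
  vertical   h x y = count (λ v → adj Σ y v ∧ h (x , v)) (verts Σ)
  horizontal h x y = count (λ u → adj Γ x u ∧ h (u , y)) (verts Γ)

  count-neighbours□ : ∀ (h : V P → Bool) x y →
    count (λ z → adj P (x , y) z ∧ h z) (verts P) ≡ vertical h x y + horizontal h x y
  count-neighbours□ h x y = begin
    count (λ z → adj P (x , y) z ∧ h z) (verts P)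
      ≡⟨ sumOver-cartesianProductWith _,_ _ (verts Γ) (verts Σ) ⟩
    sumOver (verts Γ) (λ u → count (λ v → adj P (x , y) (u , v) ∧ h (u , v)) (verts Σ))
      ≡⟨ sumOver-cong row (verts Γ) ⟩
    sumOver (verts Γ) (λ u → bit (does (eqV Γ x u)) * vertical h u y + bit (adj Γ x u ∧ h (u , y)))
      ≡⟨ sumOver-+ _ _ (verts Γ) ⟩
    sumOver (verts Γ) (λ u → bit (does (eqV Γ x u)) * vertical h u y) + horizontal h x y
      ≡⟨ cong (_+ horizontal h x y) (sumOver-once (eqV Γ) (verts Γ) (once wfΓ x) (λ u → vertical h u y)) ⟩
    vertical h x y + horizontal h x y  ∎
    where
    open ≡-Reasoning
    -- The row u of the product contributes the vertical part if u = x, and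
    -- at most the single vertex (u, y) if u is a neighbour of x.
    row : ∀ u → count (λ v → adj P (x , y) (u , v) ∧ h (u , v)) (verts Σ) ≡
                bit (does (eqV Γ x u)) * vertical h u y + bit (adj Γ x u ∧ h (u , y))
    row u with eqV Γ x u
    ... | yes refl rewrite loopless wfΓ x =
          trans (count-cong (λ v → cong (_∧ h (x , v)) (∨-identityʳ (adj Σ y v))) (verts Σ))
                (sym (trans (+-identityʳ _) (*-identityˡ _)))
    ... | no _ with adj Γ x u
    ...   | false = count-false (verts Σ)
    ...   | true  = count-once (eqV Σ) (verts Σ) (once wfΣ y) (λ v → h (u , v))

  nbrsIn□ : ∀ j x y → nbrsIn P D j (x , y) ≡
    vertical (layer P D j) x y + horizontal (layer P D j) x y
  nbrsIn□ j x y = trans (nbrsIn-as-count P D j (x , y)) (count-neighbours□ (layer P D j) x y)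

  -- If C × C' is completely regular and C' contains a codeword, then C is
  -- completely regular: fix a codeword y; for x, x' in the same layer of C
  -- the vertical parts of (x, y) and (x', y) agree, and the horizontal parts
  -- count the neighbours of x, resp. x', in C_j.
  regularˡ : CompletelyRegular P D → ∀ {y} → T (C' y) → CompletelyRegular Γ C
  regularˡ cr {y} cy i j x x' lx lx' = +-cancelˡ-≡ (vertical L x y) _ _ (begin
    vertical L x y  + nbrsIn Γ C j x   ≡⟨ sym (split x) ⟩
    nbrsIn P D j (x , y)               ≡⟨ cr i j _ _ (onFibre x lx) (onFibre x' lx') ⟩
    nbrsIn P D j (x' , y)              ≡⟨ split x' ⟩
    vertical L x' y + nbrsIn Γ C j x'  ≡⟨ cong (_+ nbrsIn Γ C j x') (sym vertical-same) ⟩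
    vertical L x y  + nbrsIn Γ C j x'  ∎)
    where
    open ≡-Reasoning
    L : V P → Bool
    L = layer P D j
    fibre-layer : ∀ k u → layer P D k (u , y) ≡ layer Γ C k u
    fibre-layer k u = layer-cong (λ m → within□-fibreˡ cy m u) k
    onFibre : ∀ u → T (layer Γ C i u) → T (layer P D i (u , y))
    onFibre u = subst T (sym (fibre-layer i u))
    split : ∀ u → nbrsIn P D j (u , y) ≡ vertical L u y + nbrsIn Γ C j u
    split u = trans (nbrsIn□ j u y) (cong (vertical L u y +_) (begin
      horizontal L u y                                    ≡⟨ count-cong (λ u' → cong (adj Γ u u' ∧_) (fibre-layer j u')) (verts Γ) ⟩
      count (λ u' → adj Γ u u' ∧ layer Γ C j u') (verts Γ) ≡⟨ sym (nbrsIn-as-count Γ C j u) ⟩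
      nbrsIn Γ C j u                                      ∎))
    vertical-same : vertical L x y ≡ vertical L x' y
    vertical-same = count-cong
      (λ v → cong (adj Σ y v ∧_) (layer-cong (within□-cong (DΓ.sameLayer⇒sameDistance i lx lx') (λ _ → refl)) j))
      (verts Σ)

  regularʳ : CompletelyRegular P D → ∀ {x} → T (C x) → CompletelyRegular Σ C'
  regularʳ cr {x} cx i j y y' ly ly' = +-cancelʳ-≡ (horizontal L x y) _ _ (begin
    nbrsIn Σ C' j y  + horizontal L x y  ≡⟨ sym (split y) ⟩
    nbrsIn P D j (x , y)                 ≡⟨ cr i j _ _ (onFibre y ly) (onFibre y' ly') ⟩
    nbrsIn P D j (x , y')                ≡⟨ split y' ⟩
    nbrsIn Σ C' j y' + horizontal L x y' ≡⟨ cong (nbrsIn Σ C' j y' +_) (sym horizontal-same) ⟩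
    nbrsIn Σ C' j y' + horizontal L x y  ∎)
    where
    open ≡-Reasoning
    L : V P → Bool
    L = layer P D j
    fibre-layer : ∀ k v → layer P D k (x , v) ≡ layer Σ C' k v
    fibre-layer k v = layer-cong (λ m → within□-fibreʳ cx m v) k
    onFibre : ∀ v → T (layer Σ C' i v) → T (layer P D i (x , v))
    onFibre v = subst T (sym (fibre-layer i v))
    split : ∀ v → nbrsIn P D j (x , v) ≡ nbrsIn Σ C' j v + horizontal L x v
    split v = trans (nbrsIn□ j x v) (cong (_+ horizontal L x v) (begin
      vertical L x v                                       ≡⟨ count-cong (λ v' → cong (adj Σ v v' ∧_) (fibre-layer j v')) (verts Σ) ⟩
      count (λ v' → adj Σ v v' ∧ layer Σ C' j v') (verts Σ) ≡⟨ sym (nbrsIn-as-count Σ C' j v) ⟩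
      nbrsIn Σ C' j v                                      ∎))
    horizontal-same : horizontal L x y ≡ horizontal L x y'
    horizontal-same = count-cong
      (λ u → cong (adj Γ x u ∧_) (layer-cong (within□-cong (λ _ → refl) (DΣ.sameLayer⇒sameDistance i ly ly')) j))
      (verts Γ)

-- Proposition 3.1: if C × C' is completely regular in H(n,q) × H(n',q')
-- then C and C' are completely regular.  Non-triviality is used only to
-- supply a codeword in each factor.
proposition3p1 : (n q n' q' : ℕ) (C : Code (Hamming n q)) (C' : Code (Hamming n' q')) →
    NonTrivial (Hamming n q) C → NonTrivial (Hamming n' q') C' →
    CompletelyRegular (Hamming n q □ Hamming n' q') (λ { (x , y) → C x ∧ C' y }) →
    CompletelyRegular (Hamming n q) C × CompletelyRegular (Hamming n' q') C'
proposition3p1 n q n' q' C C' ((x , _ , cx , _) , _) ((y , _ , cy , _) , _) cr =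
  regularˡ cr cy , regularʳ cr cx
  where
  open Product (hamming-wellFormed n q) (hamming-wellFormed n' q') C C'
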